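{- Let $D\ge 1$ be an integer and $\rho=\rho(D)\le 1/D$. Then $Q^D_\rho$ contains a maximal monotone path with probability at least $(\rho D/(2\mathrm{e}))^D$.
   Context: $Q^D$ is the $D$-dimensional binary hypercube (vertex set $\{0,1\}^D$, edges between vertices differing in exactly one coordinate), and $Q^D_\rho$ is obtained by retaining each edge of $Q^D$ independently with probability $\rho$. The $i$-th layer of $Q^D$ is the set of vertices with exactly $i$ coordinates equal to $1$. A monotone path is a path containing at most one vertex on each layer; it is maximal if its length (number of edges) equals $D$.
   Formalization: The retention probability ρ ranges over the rationals. -}

module Defs where

open import Data.Nat as ℕ using (ℕ; zero; suc; _∸_)
open import Data.Integer using (+_)
open import Data.Rational as ℚ using (ℚ; 0ℚ; 1ℚ; _+_; _*_; _-_; _/_)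
open import Data.Bool using (Bool; true; false; if_then_else_)
open import Data.Bool.Properties using () renaming (_≟_ to _≟𝔹_)
open import Data.Fin using (Fin; zero; suc; inject₁)
open import Data.Vec using (Vec; []; _∷_; lookup; _[_]≔_)
open import Data.List as List using (List; []; _∷_; _++_; map; concatMap; filter; allFin; length)
open import Data.List.Membership.Propositional using (_∈_)
open import Data.Product using (Σ; _×_; _,_)
open import Data.Sum using (_⊎_)
open import Function using (_∘_)
open import Function.Definitions using (Injective)
open import Relation.Binary.PropositionalEquality using (_≡_)
open import Relation.Nullary using (Dec; does)

-- vertices of Q^D: elements of {0,1}^D (false = 0, true = 1)
V : ℕ → Set
V D = Vec Bool D

vertices : (D : ℕ) → List (V D)
vertices zero    = [] ∷ []
vertices (suc D) = map (false ∷_) (vertices D) ++ map (true ∷_) (vertices D)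

-- an edge is recorded as an ordered pair (u , w) with u below w
Edge : ℕ → Set
Edge D = V D × V D

edgesFrom : {D : ℕ} → V D → List (Edge D)
edgesFrom {D} v =
  map (λ i → v , (v [ i ]≔ true)) (filter (λ i → lookup v i ≟𝔹 false) (allFin D))

edges : (D : ℕ) → List (Edge D)
edges D = concatMap edgesFrom (vertices D)

layer : {D : ℕ} → V D → ℕ
layer []           = 0
layer (true ∷ v)   = suc (layer v)
layer (false ∷ v)  = layer v

-- Spanning subgraphs of Q^D, given by their (sub)list of retained edges

Subgraph : ℕ → Set
Subgraph D = List (Edge D)

Adjacent : {D : ℕ} → Subgraph D → V D → V D → Set
Adjacent S u w = ((u , w) ∈ S) ⊎ ((w , u) ∈ S)

-- a maximal monotone path in S: a path w₀,…,w_D (D edges, so D+1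
-- distinct vertices, consecutive ones adjacent in S) with at most one
-- vertex on each layer
HasMaxMonotonePath : {D : ℕ} → Subgraph D → Set
HasMaxMonotonePath {D} S =
  Σ (Fin (suc D) → V D) λ w →
      ((k : Fin D) → Adjacent S (w (inject₁ k)) (w (suc k)))
    × Injective _≡_ _≡_ w
    × Injective _≡_ _≡_ (layer ∘ w)

-- all sublists of a list (= all subsets, for a duplicate-free list)
sublists : {A : Set} → List A → List (List A)
sublists []       = [] ∷ []
sublists (x ∷ xs) = map (x ∷_) (sublists xs) ++ sublists xs

infixr 8 _^_
_^_ : ℚ → ℕ → ℚ
p ^ zero  = 1ℚ
p ^ suc n = p * (p ^ n)

sumℚ : List ℚ → ℚ
sumℚ = List.foldr _+_ 0ℚ

-- probability that the subgraph Q^D_ρ (each edge kept independently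
-- with probability ρ) satisfies a decidable property P
Prob : (D : ℕ) (ρ : ℚ) (P : Subgraph D → Set) → ((S : Subgraph D) → Dec (P S)) → ℚ
Prob D ρ P dec =
  sumℚ (map (λ S → if does (dec S)
                     then ρ ^ length S * (1ℚ - ρ) ^ (length (edges D) ∸ length S)
                     else 0ℚ)
            (sublists (edges D)))

expTerm : ℚ → ℕ → ℚ
expTerm x zero    = 1ℚ
expTerm x (suc k) = expTerm x k * x * ((+ 1) / suc k)

expPartial : ℚ → ℕ → ℚ
expPartial x zero    = 0ℚ
expPartial x (suc N) = expPartial x N + expTerm x N

-- Explore Q^D_ρ greedily from the bottom vertex: at a vertex on layer D - m, inspect its m
-- upward edges in a fixed order and follow the first one that is present. A run of the walk
-- is a pattern ⟨ O , C ⟩ of edges seen present and absent. No edge is inspected twice, so a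
-- run occurs with probability ρ^|O| (1-ρ)^|C|; for each S at most one run occurs, and a run
-- that occurs traces a maximal monotone path. Summing over runs, the walk reaches the top
-- with probability ∏_{m=1}^{D} (1 - (1-ρ)^m). As ρm ≤ 1, Bonferroni gives
-- 1 - (1-ρ)^m ≥ ρm - ρ²m(m-1)/2 ≥ ρm/2, so the probability is at least ρ^D D!/2^D, and
-- D^D/D! is a single term of the exponential series of e^D.
module Submission where

open import Defs
open import Data.Nat using (ℕ; _≥_)
open import Data.Integer using (+_)
open import Data.Rational using (ℚ; 0ℚ; _≤_; _<_; _*_; _+_; _/_)
open import Data.Product using (∃)
open import Relation.Nullary using (Dec)

open import Data.Bool using (true; false; if_then_else_)
import Data.Bool.Properties as BoolP
open import Data.Fin using (Fin; zero; suc; toℕ; inject₁)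
import Data.Fin.Properties as FinP
import Data.Integer as ℤ
import Data.Integer.Properties as ℤP
open import Data.List using (List; []; _∷_; _++_; map; length; filter; tabulate; allFin)
import Data.List.Properties as ListP
open import Data.List.Membership.Propositional using (_∈_; _∉_)
import Data.List.Membership.Propositional.Properties as ∈P
open import Data.List.Relation.Binary.Disjoint.Propositional using (Disjoint)
open import Data.List.Relation.Binary.Subset.Propositional using (_⊆_)
import Data.List.Relation.Binary.Subset.Propositional.Properties as ⊆P
open import Data.List.Relation.Unary.All as All using (All; []; _∷_)
import Data.List.Relation.Unary.All.Properties as AllP
import Data.List.Relation.Unary.AllPairs as AllPairs
import Data.List.Relation.Unary.AllPairs.Properties as AllPairsP
open import Data.List.Relation.Unary.Any as Any using (here; there)
open import Data.List.Relation.Unary.Unique.Propositional using (Unique)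
import Data.List.Relation.Unary.Unique.Propositional.Properties as UniqueP
open import Data.Nat as ℕ using (zero; suc; z≤n; s≤s; _∸_)
import Data.Nat.Properties as ℕP
open import Data.Product as Product using (_×_; _,_; proj₁; proj₂; ∃-syntax)
import Data.Product.Properties as ProductP
open import Data.Rational using (1ℚ; _-_; -_; toℚᵘ; nonNegative)
import Data.Rational.Properties as ℚP
open import Data.Rational.Solver using (module +-*-Solver)
import Data.Rational.Unnormalised as ℚᵘ
import Data.Rational.Unnormalised.Properties as ℚᵘP
open import Data.Sum as Sum using (_⊎_; inj₁; inj₂; [_,_])
open import Data.Vec using ([]; _∷_; lookup; _[_]≔_; replicate)
import Data.Vec.Properties as VecP
open import Function using (_∘_; id)
open import Relation.Binary.Definitions using (DecidableEquality)
open import Relation.Binary.PropositionalEquality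
  using (_≡_; _≢_; refl; sym; trans; cong; cong₂; subst; module ≡-Reasoning)
open import Relation.Nullary using (yes; no; does; ¬_; ¬?; _×-dec_; contradiction)

open +-*-Solver using (solve; _:=_; _:+_; _:*_; _:-_; con)

fromℕ : ℕ → ℚ
fromℕ n = + n / 1

½ : ℚ
½ = + 1 / 2

private
  toℚᵘ-/ : ∀ a b → toℚᵘ (+ a / suc b) ℚᵘ.≃ ℚᵘ.mkℚᵘ (+ a) b
  toℚᵘ-/ a b = ℚP.toℚᵘ-fromℚᵘ (ℚᵘ.mkℚᵘ (+ a) b)

fromℕ-suc : ∀ n → fromℕ (suc n) ≡ 1ℚ + fromℕ n
fromℕ-suc n = ℚP.toℚᵘ-injective (begin
  toℚᵘ (fromℕ (suc n))                    ≈⟨ toℚᵘ-/ (suc n) 0 ⟩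
  ℚᵘ.mkℚᵘ (+ suc n) 0                     ≈⟨ ℚᵘ.*≡* cross-multiplied ⟩
  ℚᵘ.mkℚᵘ (+ 1) 0 ℚᵘ.+ ℚᵘ.mkℚᵘ (+ n) 0   ≈⟨ ℚᵘP.+-cong (toℚᵘ-/ 1 0) (toℚᵘ-/ n 0) ⟨
  toℚᵘ 1ℚ ℚᵘ.+ toℚᵘ (fromℕ n)             ≈⟨ ℚP.toℚᵘ-homo-+ 1ℚ (fromℕ n) ⟨
  toℚᵘ (1ℚ + fromℕ n)                     ∎)
  where
  open ℚᵘP.≃-Reasoning
  cross-multiplied : + suc n ℤ.* + 1 ≡ (+ 1 ℤ.+ + n ℤ.* + 1) ℤ.* + 1
  cross-multiplied = trans (ℤP.*-identityʳ _)
    (sym (trans (ℤP.*-identityʳ _) (cong (ℤ._+_ (+ 1)) (ℤP.*-identityʳ (+ n)))))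

fromℕ*1/ : ∀ a b → fromℕ a * (+ 1 / suc b) ≡ + a / suc b
fromℕ*1/ a b = ℚP.toℚᵘ-injective (begin
  toℚᵘ (fromℕ a * (+ 1 / suc b))          ≈⟨ ℚP.toℚᵘ-homo-* (fromℕ a) _ ⟩
  toℚᵘ (fromℕ a) ℚᵘ.* toℚᵘ (+ 1 / suc b)  ≈⟨ ℚᵘP.*-cong (toℚᵘ-/ a 0) (toℚᵘ-/ 1 b) ⟩
  ℚᵘ.mkℚᵘ (+ a) 0 ℚᵘ.* ℚᵘ.mkℚᵘ (+ 1) b   ≈⟨ ℚᵘ.*≡* (ℤP.*-assoc (+ a) (+ 1) (+ suc b)) ⟩
  ℚᵘ.mkℚᵘ (+ a) b                         ≈⟨ toℚᵘ-/ a b ⟨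
  toℚᵘ (+ a / suc b)                      ∎)
  where open ℚᵘP.≃-Reasoning

n/n≡1 : ∀ n → + suc n / suc n ≡ 1ℚ
n/n≡1 n = ℚP.toℚᵘ-injective
  (ℚᵘP.≃-trans (toℚᵘ-/ (suc n) n) (ℚᵘ.*≡* (ℤP.*-comm (+ suc n) (+ 1))))

/-nonNeg : ∀ a b → 0ℚ ≤ + a / suc b
/-nonNeg a b = ℚP.nonNegative⁻¹ _ {{ℚP.normalize-nonNeg a (suc b)}}

0≤1 : 0ℚ ≤ 1ℚ
0≤1 = /-nonNeg 1 0

0≤½ : 0ℚ ≤ ½
0≤½ = /-nonNeg 1 1

*-nonNeg : ∀ {p q} → 0ℚ ≤ p → 0ℚ ≤ q → 0ℚ ≤ p * q
*-nonNeg {p} {q} 0≤p 0≤q =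
  ℚP.nonNegative⁻¹ (p * q) {{ℚP.nonNeg*nonNeg⇒nonNeg p {{nonNegative 0≤p}} q {{nonNegative 0≤q}}}}

+-nonNeg : ∀ {p q} → 0ℚ ≤ p → 0ℚ ≤ q → 0ℚ ≤ p + q
+-nonNeg = ℚP.+-mono-≤

*-monoˡ-≤ : ∀ {r p q} → 0ℚ ≤ r → p ≤ q → r * p ≤ r * q
*-monoˡ-≤ {r} 0≤r = ℚP.*-monoˡ-≤-nonNeg r {{nonNegative 0≤r}}

*-monoʳ-≤ : ∀ {r p q} → 0ℚ ≤ r → p ≤ q → p * r ≤ q * r
*-monoʳ-≤ {r} 0≤r = ℚP.*-monoʳ-≤-nonNeg r {{nonNegative 0≤r}}

*-mono-≤ : ∀ {p p′ q q′} → 0ℚ ≤ p → 0ℚ ≤ q → p ≤ p′ → q ≤ q′ → p * q ≤ p′ * q′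
*-mono-≤ 0≤p 0≤q p≤p′ q≤q′ =
  ℚP.≤-trans (*-monoʳ-≤ 0≤q p≤p′) (*-monoˡ-≤ (ℚP.≤-trans 0≤p p≤p′) q≤q′)

p≤p+q : ∀ {p q} → 0ℚ ≤ q → p ≤ p + q
p≤p+q {p} 0≤q = subst (_≤ p + _) (ℚP.+-identityʳ p) (ℚP.+-monoʳ-≤ p 0≤q)

q≤p+q : ∀ {p q} → 0ℚ ≤ p → q ≤ p + q
q≤p+q {p} {q} 0≤p = subst (_≤ p + q) (ℚP.+-identityˡ q) (ℚP.+-monoˡ-≤ q 0≤p)

p-q≤p : ∀ {p q} → 0ℚ ≤ q → p - q ≤ p
p-q≤p {p} 0≤q = subst (p - _ ≤_) (ℚP.+-identityʳ p) (ℚP.+-monoʳ-≤ p (ℚP.neg-antimono-≤ 0≤q))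

0≤1-p : ∀ {p} → p ≤ 1ℚ → 0ℚ ≤ 1ℚ - p
0≤1-p {p} p≤1 = subst (_≤ 1ℚ - p) (ℚP.+-inverseʳ p) (ℚP.+-monoˡ-≤ (- p) p≤1)

fromℕ-mono-≤ : ∀ {m n} → m ℕ.≤ n → fromℕ m ≤ fromℕ n
fromℕ-mono-≤ {n = n} z≤n = /-nonNeg n 0
fromℕ-mono-≤ {suc m} {suc n} (s≤s m≤n) rewrite fromℕ-suc m | fromℕ-suc n =
  ℚP.+-monoʳ-≤ 1ℚ (fromℕ-mono-≤ m≤n)

^-nonNeg : ∀ {r} n → 0ℚ ≤ r → 0ℚ ≤ r ^ n
^-nonNeg zero    0≤r = 0≤1
^-nonNeg (suc n) 0≤r = *-nonNeg 0≤r (^-nonNeg n 0≤r)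

^-≤1 : ∀ {r} n → 0ℚ ≤ r → r ≤ 1ℚ → r ^ n ≤ 1ℚ
^-≤1     zero    0≤r r≤1 = ℚP.≤-refl
^-≤1 {r} (suc n) 0≤r r≤1 =
  subst (r * r ^ n ≤_) (ℚP.*-identityʳ 1ℚ) (*-mono-≤ 0≤r (^-nonNeg n 0≤r) r≤1 (^-≤1 n 0≤r r≤1))

^-antimono-≤ : ∀ {r m n} → 0ℚ ≤ r → r ≤ 1ℚ → m ℕ.≤ n → r ^ n ≤ r ^ m
^-antimono-≤ {n = n} 0≤r r≤1 z≤n       = ^-≤1 n 0≤r r≤1
^-antimono-≤         0≤r r≤1 (s≤s m≤n) = *-monoˡ-≤ 0≤r (^-antimono-≤ 0≤r r≤1 m≤n)

expTerm-nonNeg : ∀ {x} → 0ℚ ≤ x → ∀ k → 0ℚ ≤ expTerm x k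
expTerm-nonNeg 0≤x zero    = 0≤1
expTerm-nonNeg 0≤x (suc k) = *-nonNeg (*-nonNeg (expTerm-nonNeg 0≤x k) 0≤x) (/-nonNeg 1 k)

expPartial-nonNeg : ∀ {x} → 0ℚ ≤ x → ∀ k → 0ℚ ≤ expPartial x k
expPartial-nonNeg 0≤x zero    = ℚP.≤-refl
expPartial-nonNeg 0≤x (suc k) = +-nonNeg (expPartial-nonNeg 0≤x k) (expTerm-nonNeg 0≤x k)

sum-++ : ∀ (xs ys : List ℚ) → sumℚ (xs ++ ys) ≡ sumℚ xs + sumℚ ys
sum-++ []       ys = sym (ℚP.+-identityˡ _)
sum-++ (x ∷ xs) ys = trans (cong (_+_ x) (sum-++ xs ys)) (sym (ℚP.+-assoc x _ _))

module _ {A : Set} where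

  sum-cong : ∀ {f g : A → ℚ} xs → All (λ x → f x ≡ g x) xs → sumℚ (map f xs) ≡ sumℚ (map g xs)
  sum-cong []       []            = refl
  sum-cong (x ∷ xs) (fx≡gx ∷ f≡g) = cong₂ _+_ fx≡gx (sum-cong xs f≡g)

  sum-mono : ∀ {f g : A → ℚ} xs → All (λ x → f x ≤ g x) xs → sumℚ (map f xs) ≤ sumℚ (map g xs)
  sum-mono []       []            = ℚP.≤-refl
  sum-mono (x ∷ xs) (fx≤gx ∷ f≤g) = ℚP.+-mono-≤ fx≤gx (sum-mono xs f≤g)

  *-distribˡ-sum : ∀ c (f : A → ℚ) xs → c * sumℚ (map f xs) ≡ sumℚ (map (λ x → c * f x) xs)
  *-distribˡ-sum c f []       = ℚP.*-zeroʳ c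
  *-distribˡ-sum c f (x ∷ xs) =
    trans (ℚP.*-distribˡ-+ c (f x) _) (cong (_+_ (c * f x)) (*-distribˡ-sum c f xs))

  sum-map-scaled : ∀ (f : A → A) (w : A → ℚ) c xs → (∀ x → w (f x) ≡ c * w x) →
                   sumℚ (map w (map f xs)) ≡ c * sumℚ (map w xs)
  sum-map-scaled f w c xs w∘f≡c*w = trans (cong sumℚ (sym (ListP.map-∘ {g = w} {f = f} xs)))
    (trans (sum-cong xs (All.universal w∘f≡c*w xs)) (sym (*-distribˡ-sum c w xs)))

map⁺-Unique-on : ∀ {A B : Set} {P : A → Set} {f : A → B} {xs} →
                 (∀ {x y} → P x → P y → f x ≡ f y → x ≡ y) →
                 All P xs → Unique xs → Unique (map f xs)
map⁺-Unique-on inj []         AllPairs.[]         = AllPairs.[]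
map⁺-Unique-on inj (px ∷ pxs) (x≢xs AllPairs.∷ u) =
  AllP.map⁺ (All.zipWith (λ (py , x≢y) fx≡fy → x≢y (inj px py fx≡fy)) (pxs , x≢xs))
  AllPairs.∷ map⁺-Unique-on inj pxs u

𝟙 : {P : Set} → Dec P → ℚ
𝟙 P? = if does P? then 1ℚ else 0ℚ

𝟙-nonNeg : ∀ {P : Set} (P? : Dec P) → 0ℚ ≤ 𝟙 P?
𝟙-nonNeg (yes _) = 0≤1
𝟙-nonNeg (no _)  = ℚP.≤-refl

𝟙-mono : ∀ {P Q : Set} (P? : Dec P) (Q? : Dec Q) → (P → Q) → 𝟙 P? ≤ 𝟙 Q?
𝟙-mono (yes _) (yes _) _   = ℚP.≤-refl
𝟙-mono (yes p) (no ¬q) P→Q = contradiction (P→Q p) ¬q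
𝟙-mono (no _)  Q?      _   = 𝟙-nonNeg Q?

𝟙-cong : ∀ {P Q : Set} (P? : Dec P) (Q? : Dec Q) → (P → Q) → (Q → P) → 𝟙 P? ≡ 𝟙 Q?
𝟙-cong P? Q? P→Q Q→P = ℚP.≤-antisym (𝟙-mono P? Q? P→Q) (𝟙-mono Q? P? Q→P)

𝟙-×-dec : ∀ {P Q : Set} (P? : Dec P) (Q? : Dec Q) → 𝟙 (P? ×-dec Q?) ≡ 𝟙 P? * 𝟙 Q?
𝟙-×-dec (yes _) Q? = sym (ℚP.*-identityˡ (𝟙 Q?))
𝟙-×-dec (no _)  Q? = sym (ℚP.*-zeroˡ (𝟙 Q?))

if-does-then-else-0 : ∀ {P : Set} (P? : Dec P) w → (if does P? then w else 0ℚ) ≡ 𝟙 P? * w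
if-does-then-else-0 (yes _) w = sym (ℚP.*-identityˡ w)
if-does-then-else-0 (no _)  w = sym (ℚP.*-zeroˡ w)

ZeroOrOneWith : ℚ → Set → Set
ZeroOrOneWith x P = x ≡ 0ℚ ⊎ (x ≡ 1ℚ × P)

ZeroOrOneWith-map : ∀ {x y P Q} → x ≡ y → (P → Q) → ZeroOrOneWith y P → ZeroOrOneWith x Q
ZeroOrOneWith-map x≡y f (inj₁ y≡0)       = inj₁ (trans x≡y y≡0)
ZeroOrOneWith-map x≡y f (inj₂ (y≡1 , p)) = inj₂ (trans x≡y y≡1 , f p)

ZeroOrOneWith⇒≤𝟙 : ∀ {x P Q} → ZeroOrOneWith x P → (Q? : Dec Q) → (P → Q) → x ≤ 𝟙 Q?
ZeroOrOneWith⇒≤𝟙 (inj₁ refl)       Q?      _   = 𝟙-nonNeg Q?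
ZeroOrOneWith⇒≤𝟙 (inj₂ (refl , p)) (yes _) _   = ℚP.≤-refl
ZeroOrOneWith⇒≤𝟙 (inj₂ (refl , p)) (no ¬q) P→Q = contradiction (P→Q p) ¬q

record Pattern (A : Set) : Set where
  constructor ⟨_,_⟩
  field
    opened closed : List A

open Pattern public

module _ {A : Set} where

  addOpened addClosed : A → Pattern A → Pattern A
  addOpened x p = ⟨ x ∷ opened p , closed p ⟩
  addClosed x p = ⟨ opened p , x ∷ closed p ⟩

  Supported : List A → Pattern A → Set
  Supported xs p = opened p ⊆ xs × closed p ⊆ xs × Disjoint (opened p) (closed p)

  Occurs : Pattern A → List A → Set
  Occurs p S = All (_∈ S) (opened p) × All (_∉ S) (closed p)

module Occurrence {A : Set} (_≟_ : DecidableEquality A) where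

  open import Data.List.Membership.DecPropositional _≟_ using (_∈?_; _∉?_)

  occurs? : ∀ p S → Dec (Occurs p S)
  occurs? p S = All.all? (_∈? S) (opened p) ×-dec All.all? (_∉? S) (closed p)

  𝟙[_occurs-in_] : Pattern A → List A → ℚ
  𝟙[ p occurs-in S ] = 𝟙 (occurs? p S)

  𝟙[occurs]-mono : ∀ {p p′ S S′} → (Occurs p S → Occurs p′ S′) → 𝟙[ p occurs-in S ] ≤ 𝟙[ p′ occurs-in S′ ]
  𝟙[occurs]-mono {p} {p′} {S} {S′} = 𝟙-mono (occurs? p S) (occurs? p′ S′)

  count : List (Pattern A) → List A → ℚ
  count ps S = sumℚ (map 𝟙[_occurs-in S ] ps)

  count-++ : ∀ ps qs S → count (ps ++ qs) S ≡ count ps S + count qs S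
  count-++ ps qs S = trans (cong sumℚ (ListP.map-++ 𝟙[_occurs-in S ] ps qs))
                           (sum-++ (map 𝟙[_occurs-in S ] ps) (map 𝟙[_occurs-in S ] qs))

  count-addOpened : ∀ x ps S → count (map (addOpened x) ps) S ≡ 𝟙 (x ∈? S) * count ps S
  count-addOpened x ps S = sum-map-scaled (addOpened x) 𝟙[_occurs-in S ] (𝟙 (x ∈? S)) ps λ p →
    trans (𝟙-cong (occurs? (addOpened x p) S) ((x ∈? S) ×-dec occurs? p S)
                  (λ { (x∈S ∷ os , cs) → x∈S , os , cs })
                  (λ { (x∈S , os , cs) → x∈S ∷ os , cs }))
          (𝟙-×-dec (x ∈? S) (occurs? p S))

  count-addClosed : ∀ x ps S → count (map (addClosed x) ps) S ≡ 𝟙 (x ∉? S) * count ps S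
  count-addClosed x ps S = sum-map-scaled (addClosed x) 𝟙[_occurs-in S ] (𝟙 (x ∉? S)) ps λ p →
    trans (𝟙-cong (occurs? (addClosed x p) S) ((x ∉? S) ×-dec occurs? p S)
                  (λ { (os , x∉S ∷ cs) → x∉S , os , cs })
                  (λ { (x∉S , os , cs) → os , x∉S ∷ cs }))
          (𝟙-×-dec (x ∉? S) (occurs? p S))

∈-vertices : ∀ {n} (v : V n) → v ∈ vertices n
∈-vertices []          = here refl
∈-vertices (false ∷ v) = ∈P.∈-++⁺ˡ (∈P.∈-map⁺ (false ∷_) (∈-vertices v))
∈-vertices {suc n} (true ∷ v) =
  ∈P.∈-++⁺ʳ (map (false ∷_) (vertices n)) (∈P.∈-map⁺ (true ∷_) (∈-vertices v))

vertices-unique : ∀ n → Unique (vertices n)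
vertices-unique zero    = [] AllPairs.∷ AllPairs.[]
vertices-unique (suc n) = UniqueP.++⁺ (UniqueP.map⁺ VecP.∷-injectiveʳ (vertices-unique n))
                                      (UniqueP.map⁺ VecP.∷-injectiveʳ (vertices-unique n))
                                      false≢true
  where
  false≢true : Disjoint (map (false ∷_) (vertices n)) (map (true ∷_) (vertices n))
  false≢true (v∈ , w∈) with ∈P.∈-map⁻ (false ∷_) v∈ | ∈P.∈-map⁻ (true ∷_) w∈
  ... | _ , _ , refl | _ , _ , ()

layer-replicate : ∀ n → layer (replicate n false) ≡ 0
layer-replicate zero    = refl
layer-replicate (suc n) = layer-replicate n

layer-[]≔true : ∀ {n} (v : V n) i → lookup v i ≡ false → layer (v [ i ]≔ true) ≡ suc (layer v)
layer-[]≔true (false ∷ v) zero    refl = refl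
layer-[]≔true (true ∷ v)  (suc i) vᵢ≡0 = cong suc (layer-[]≔true v i vᵢ≡0)
layer-[]≔true (false ∷ v) (suc i) vᵢ≡0 = layer-[]≔true v i vᵢ≡0

module _ {D : ℕ} where

  _≟ᵉ_ : DecidableEquality (Edge D)
  _≟ᵉ_ = ProductP.≡-dec (VecP.≡-dec BoolP._≟_) (VecP.≡-dec BoolP._≟_)

  private
    free? : ∀ (v : V D) i → Dec (lookup v i ≡ false)
    free? v i = lookup v i BoolP.≟ false

  ∈-edgesFrom⁻ : ∀ {v e} → e ∈ edgesFrom v → ∃[ i ] lookup v i ≡ false × e ≡ (v , v [ i ]≔ true)
  ∈-edgesFrom⁻ {v} e∈ with ∈P.∈-map⁻ (λ i → v , v [ i ]≔ true) e∈
  ... | i , i∈ , refl = i , proj₂ (∈P.∈-filter⁻ (free? v) {xs = allFin D} i∈) , refl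

  edgesFrom-source : ∀ {v e} → e ∈ edgesFrom v → proj₁ e ≡ v
  edgesFrom-source e∈ with ∈-edgesFrom⁻ e∈
  ... | _ , _ , refl = refl

  edgesFrom-layer : ∀ {v e} → e ∈ edgesFrom v → layer (proj₂ e) ≡ suc (layer v)
  edgesFrom-layer {v} e∈ with ∈-edgesFrom⁻ e∈
  ... | i , vᵢ≡0 , refl = layer-[]≔true v i vᵢ≡0

  edgesFrom⊆edges : ∀ {v} → edgesFrom v ⊆ edges D
  edgesFrom⊆edges {v} e∈ = ∈P.∈-concat⁺′ e∈ (∈P.∈-map⁺ edgesFrom (∈-vertices v))

  edgesFrom-unique : ∀ v → Unique (edgesFrom v)
  edgesFrom-unique v = map⁺-Unique-on raise-injective
    (AllP.all-filter (free? v) (allFin D)) (UniqueP.filter⁺ (free? v) (UniqueP.allFin⁺ D))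
    where
    raise-injective : ∀ {i j} → lookup v i ≡ false → lookup v j ≡ false →
                      (v , v [ i ]≔ true) ≡ (v , v [ j ]≔ true) → i ≡ j
    raise-injective {i} {j} vᵢ≡0 _ eq with i FinP.≟ j
    ... | yes i≡j = i≡j
    ... | no  i≢j = contradiction (begin
      true                     ≡⟨ VecP.lookup∘update i v true ⟨
      lookup (v [ i ]≔ true) i ≡⟨ cong (λ e → lookup (proj₂ e) i) eq ⟩
      lookup (v [ j ]≔ true) i ≡⟨ VecP.lookup∘update′ i≢j v true ⟩
      lookup v i               ≡⟨ vᵢ≡0 ⟩
      false                    ∎) λ ()
      where open ≡-Reasoning

  edges-unique : Unique (edges D)
  edges-unique = UniqueP.concat⁺ (AllP.map⁺ (All.universal edgesFrom-unique (vertices D)))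
                                 (AllPairsP.map⁺ (AllPairs.map disjoint (vertices-unique D)))
    where
    disjoint : ∀ {u w} → u ≢ w → Disjoint (edgesFrom u) (edgesFrom w)
    disjoint u≢w (e∈ , e∈′) = u≢w (trans (sym (edgesFrom-source e∈)) (edgesFrom-source e∈′))

  length-edgesFrom : ∀ v → length (edgesFrom v) ℕ.+ layer v ≡ D
  length-edgesFrom v = trans (cong (ℕ._+ layer v) (ListP.length-map _ (filter (free? v) (allFin D))))
                             (frees+layer v id (λ _ → refl))
    where
    frees+layer : ∀ {n} (u : V n) (f : Fin n → Fin D) → (∀ i → lookup v (f i) ≡ lookup u i) →
                  length (filter (free? v) (tabulate f)) ℕ.+ layer u ≡ n
    frees+layer []          f _ = refl
    frees+layer (true ∷ u)  f h rewrite h zero =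
      trans (ℕP.+-suc _ _) (cong suc (frees+layer u (f ∘ suc) (h ∘ suc)))
    frees+layer (false ∷ u) f h rewrite h zero = cong suc (frees+layer u (f ∘ suc) (h ∘ suc))

  Above : ℕ → Edge D → Set
  Above L e = e ∈ edges D × L ℕ.≤ layer (proj₁ e)

  Above-suc : ∀ {L e} → Above (suc L) e → Above L e
  Above-suc = Product.map₂ ℕP.<⇒≤

  edgesFrom-above : ∀ {v e} → e ∈ edgesFrom v → Above (layer v) e
  edgesFrom-above e∈ = edgesFrom⊆edges e∈ , ℕP.≤-reflexive (cong layer (sym (edgesFrom-source e∈)))

  edgesFrom-not-above : ∀ {v e} → e ∈ edgesFrom v → ¬ Above (suc (layer v)) e
  edgesFrom-not-above e∈ (_ , v<src) = ℕP.<-irrefl (cong layer (sym (edgesFrom-source e∈))) v<src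

  data UpPath (S : Subgraph D) : V D → ℕ → Set where
    []   : ∀ {v} → UpPath S v 0
    step : ∀ {v e n} → e ∈ S → e ∈ edgesFrom v → UpPath S (proj₂ e) n → UpPath S v (suc n)

  module _ {S : Subgraph D} where

    vertex : ∀ {v n} → UpPath S v n → Fin (suc n) → V D
    vertex {v} _            zero    = v
    vertex     (step _ _ π) (suc k) = vertex π k

    layer-vertex : ∀ {v n} (π : UpPath S v n) k → layer (vertex π k) ≡ toℕ k ℕ.+ layer v
    layer-vertex π             zero    = refl
    layer-vertex (step _ e∈ π) (suc k) =
      trans (layer-vertex π k) (trans (cong (toℕ k ℕ.+_) (edgesFrom-layer e∈)) (ℕP.+-suc _ _))

    vertex-adjacent : ∀ {v n} (π : UpPath S v n) (k : Fin n) →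
                      (vertex π (inject₁ k) , vertex π (suc k)) ∈ S
    vertex-adjacent (step {e = e} e∈S e∈ π) zero =
      subst (λ u → (u , proj₂ e) ∈ S) (edgesFrom-source e∈) e∈S
    vertex-adjacent (step _ _ π) (suc k) = vertex-adjacent π k

    UpPath⇒HasMaxMonotonePath : UpPath S (replicate D false) D → HasMaxMonotonePath S
    UpPath⇒HasMaxMonotonePath π =
      vertex π , (λ k → inj₁ (vertex-adjacent π k)) , layer-injective ∘ cong layer , layer-injective
      where
      layer-injective : ∀ {k l} → layer (vertex π k) ≡ layer (vertex π l) → k ≡ l
      layer-injective {k} {l} eq = FinP.toℕ-injective
        (ℕP.+-cancelʳ-≡ _ _ _ (trans (sym (layer-vertex π k)) (trans eq (layer-vertex π l))))

-- The greedy walk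

  open Occurrence _≟ᵉ_
  open import Data.List.Membership.DecPropositional _≟ᵉ_ using (_∈?_)

  firstOpen : (V D → List (Pattern (Edge D))) → List (Edge D) → List (Pattern (Edge D))
  firstOpen next []       = []
  firstOpen next (e ∷ es) = map (addOpened e) (next (proj₂ e)) ++ map (addClosed e) (firstOpen next es)

  -- greedy n v lists the runs of n steps of the greedy walk from v.
  greedy : ℕ → V D → List (Pattern (Edge D))
  greedy zero    v = ⟨ [] , [] ⟩ ∷ []
  greedy (suc n) v = firstOpen (greedy n) (edgesFrom v)

  firstOpen-count : ∀ {S n} next → (∀ w → ZeroOrOneWith (count (next w) S) (UpPath S w n)) →
                    ∀ {v} es → es ⊆ edgesFrom v →
                    ZeroOrOneWith (count (firstOpen next es) S) (UpPath S v (suc n))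
  firstOpen-count     next h []       _   = inj₁ refl
  firstOpen-count {S} next h (e ∷ es) es⊆ = ZeroOrOneWith-map split id (by-cases (e ∈? S))
    where
    a = count (next (proj₂ e)) S
    b = count (firstOpen next es) S
    split : count (firstOpen next (e ∷ es)) S ≡ 𝟙 (e ∈? S) * a + 𝟙 (¬? (e ∈? S)) * b
    split = trans (count-++ (map (addOpened e) (next (proj₂ e))) (map (addClosed e) (firstOpen next es)) S)
                  (cong₂ _+_ (count-addOpened e (next (proj₂ e)) S) (count-addClosed e (firstOpen next es) S))
    by-cases : ∀ e∈S? → ZeroOrOneWith (𝟙 e∈S? * a + 𝟙 (¬? e∈S?) * b) (UpPath S _ (suc _))
    by-cases (yes e∈S) = ZeroOrOneWith-map (solve 2 (λ a b → con 1ℚ :* a :+ con 0ℚ :* b := a) refl a b)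
                                           (step e∈S (es⊆ (here refl))) (h (proj₂ e))
    by-cases (no _)    = ZeroOrOneWith-map (solve 2 (λ a b → con 0ℚ :* a :+ con 1ℚ :* b := b) refl a b)
                                           id (firstOpen-count next h es (es⊆ ∘ there))

  greedy-count : ∀ n v S → ZeroOrOneWith (count (greedy n v) S) (UpPath S v n)
  greedy-count zero    v S = inj₂ (ℚP.+-identityʳ 1ℚ , [])
  greedy-count (suc n) v S = firstOpen-count (greedy n) (λ w → greedy-count n w S) (edgesFrom v) id

  WellFormed : (Edge D → Set) → (Edge D → Set) → Pattern (Edge D) → Set
  WellFormed Pₒ P꜀ p = All Pₒ (opened p) × All P꜀ (closed p) × Disjoint (opened p) (closed p)

  InOrAbove : List (Edge D) → ℕ → Edge D → Set
  InOrAbove es L e = e ∈ es ⊎ Above L e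

  -- Opened and closed edges stay disjoint because es has no repetitions and an edge out of v
  -- never starts above layer v.
  firstOpen-wellFormed : ∀ next → (∀ w → All (WellFormed (Above (layer w)) (Above (layer w))) (next w)) →
    ∀ {v} es → es ⊆ edgesFrom v → Unique es →
    All (WellFormed (InOrAbove es (suc (layer v))) (Above (layer v))) (firstOpen next es)
  firstOpen-wellFormed next h     []       _   _                      = []
  firstOpen-wellFormed next h {v} (e ∷ es) es⊆ (e≢es AllPairs.∷ u) =
    AllP.++⁺ (AllP.map⁺ (All.map opened-case (h (proj₂ e))))
             (AllP.map⁺ (All.map closed-case (firstOpen-wellFormed next h es (es⊆ ∘ there) u)))
    where
    e∈ : e ∈ edgesFrom v
    e∈ = es⊆ (here refl)
    lift : ∀ {e′} → Above (layer (proj₂ e)) e′ → Above (suc (layer v)) e′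
    lift {e′} = subst (λ L → Above L e′) (edgesFrom-layer e∈)
    opened-case : ∀ {p} → WellFormed (Above (layer (proj₂ e))) (Above (layer (proj₂ e))) p →
                  WellFormed (InOrAbove (e ∷ es) (suc (layer v))) (Above (layer v)) (addOpened e p)
    opened-case (os , cs , O∩C) =
      inj₁ (here refl) ∷ All.map (inj₂ ∘ lift) os , All.map (Above-suc ∘ lift) cs ,
      λ { (here refl , e∈C) → edgesFrom-not-above e∈ (lift (All.lookup cs e∈C))
        ; (there y∈O , y∈C) → O∩C (y∈O , y∈C) }
    closed-case : ∀ {p} → WellFormed (InOrAbove es (suc (layer v))) (Above (layer v)) p →
                  WellFormed (InOrAbove (e ∷ es) (suc (layer v))) (Above (layer v)) (addClosed e p)
    closed-case (os , cs , O∩C) =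
      All.map (Sum.map₁ there) os , edgesFrom-above e∈ ∷ cs ,
      λ { (e∈O , here refl) → [ AllP.All¬⇒¬Any e≢es , edgesFrom-not-above e∈ ] (All.lookup os e∈O)
        ; (y∈O , there y∈C) → O∩C (y∈O , y∈C) }

  greedy-wellFormed : ∀ n v → All (WellFormed (Above (layer v)) (Above (layer v))) (greedy n v)
  greedy-wellFormed zero    v = ([] , [] , λ { (() , _) }) ∷ []
  greedy-wellFormed (suc n) v = All.map (Product.map₁ (All.map [ edgesFrom-above , Above-suc ]))
    (firstOpen-wellFormed (greedy n) (greedy-wellFormed n) (edgesFrom v) id (edgesFrom-unique v))

-- Retaining each element independently with probability ρ

module Bernoulli (ρ : ℚ) (0≤ρ : 0ℚ ≤ ρ) (ρ≤1 : ρ ≤ 1ℚ) where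

  q : ℚ
  q = 1ℚ - ρ

  0≤q : 0ℚ ≤ q
  0≤q = 0≤1-p ρ≤1

  q≤1 : q ≤ 1ℚ
  q≤1 = p-q≤p 0≤ρ

  module _ {A : Set} where

    𝔼 : List A → (List A → ℚ) → ℚ
    𝔼 []       f = f []
    𝔼 (x ∷ xs) f = ρ * 𝔼 xs (f ∘ (x ∷_)) + q * 𝔼 xs f

    𝔼-mono : ∀ xs {f g} → (∀ S → S ⊆ xs → f S ≤ g S) → 𝔼 xs f ≤ 𝔼 xs g
    𝔼-mono []       f≤g = f≤g [] (λ ())
    𝔼-mono (x ∷ xs) f≤g = ℚP.+-mono-≤
      (*-monoˡ-≤ 0≤ρ (𝔼-mono xs λ S S⊆xs → f≤g (x ∷ S) (⊆P.∷⁺ʳ x S⊆xs)))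
      (*-monoˡ-≤ 0≤q (𝔼-mono xs λ S S⊆xs → f≤g S (⊆P.⊆-trans S⊆xs (⊆P.xs⊆x∷xs xs x))))

    𝔼-const : ∀ xs c → 𝔼 xs (λ _ → c) ≡ c
    𝔼-const []       c = refl
    𝔼-const (x ∷ xs) c rewrite 𝔼-const xs c =
      solve 2 (λ r c → r :* c :+ (con 1ℚ :- r) :* c := c) refl ρ c

    𝔼-nonNeg : ∀ xs {f} → (∀ S → 0ℚ ≤ f S) → 0ℚ ≤ 𝔼 xs f
    𝔼-nonNeg xs {f} 0≤f = subst (_≤ 𝔼 xs f) (𝔼-const xs 0ℚ) (𝔼-mono xs λ S _ → 0≤f S)

    𝔼-𝟙-nonNeg : ∀ xs {P : List A → Set} (P? : ∀ S → Dec (P S)) → 0ℚ ≤ 𝔼 xs (λ S → 𝟙 (P? S))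
    𝔼-𝟙-nonNeg xs P? = 𝔼-nonNeg xs λ S → 𝟙-nonNeg (P? S)

    𝔼-+ : ∀ xs f g → 𝔼 xs (λ S → f S + g S) ≡ 𝔼 xs f + 𝔼 xs g
    𝔼-+ []       f g = refl
    𝔼-+ (x ∷ xs) f g =
      trans (cong₂ (λ a b → ρ * a + q * b) (𝔼-+ xs (f ∘ (x ∷_)) (g ∘ (x ∷_))) (𝔼-+ xs f g))
            (solve 6 (λ r q a b c d → r :* (a :+ b) :+ q :* (c :+ d) := (r :* a :+ q :* c) :+ (r :* b :+ q :* d))
                   refl ρ q _ _ _ _)

    𝔼-sum : ∀ {I : Set} xs (is : List I) (f : I → List A → ℚ) →
            𝔼 xs (λ S → sumℚ (map (λ i → f i S) is)) ≡ sumℚ (map (λ i → 𝔼 xs (f i)) is)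
    𝔼-sum xs []       f = 𝔼-const xs 0ℚ
    𝔼-sum xs (i ∷ is) f = trans (𝔼-+ xs (f i) _) (cong (_+_ (𝔼 xs (f i))) (𝔼-sum xs is f))

    sublists-length : ∀ (xs : List A) → All (λ S → length S ℕ.≤ length xs) (sublists xs)
    sublists-length []       = z≤n ∷ []
    sublists-length (x ∷ xs) = AllP.++⁺ (AllP.map⁺ (All.map s≤s (sublists-length xs)))
                                        (All.map ℕP.m≤n⇒m≤1+n (sublists-length xs))

    sum-sublists≡𝔼 : ∀ xs f →
      sumℚ (map (λ S → f S * (ρ ^ length S * q ^ (length xs ∸ length S))) (sublists xs)) ≡ 𝔼 xs f
    sum-sublists≡𝔼 []       f = solve 1 (λ a → a :* (con 1ℚ :* con 1ℚ) :+ con 0ℚ := a) refl (f [])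
    sum-sublists≡𝔼 (x ∷ xs) f = begin
      sumℚ (map F (map (x ∷_) Ss ++ Ss))             ≡⟨ cong sumℚ (ListP.map-++ F (map (x ∷_) Ss) Ss) ⟩
      sumℚ (map F (map (x ∷_) Ss) ++ map F Ss)       ≡⟨ sum-++ (map F (map (x ∷_) Ss)) (map F Ss) ⟩
      sumℚ (map F (map (x ∷_) Ss)) + sumℚ (map F Ss) ≡⟨ cong₂ _+_ with-x without-x ⟩
      ρ * 𝔼 xs (f ∘ (x ∷_)) + q * 𝔼 xs f             ∎
      where
      open ≡-Reasoning
      Ss = sublists xs
      w : List A → ℚ
      w S = ρ ^ length S * q ^ (length xs ∸ length S)
      F : List A → ℚ
      F S = f S * (ρ ^ length S * q ^ (length (x ∷ xs) ∸ length S))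
      with-x : sumℚ (map F (map (x ∷_) Ss)) ≡ ρ * 𝔼 xs (f ∘ (x ∷_))
      with-x = begin
        sumℚ (map F (map (x ∷_) Ss))                 ≡⟨ cong sumℚ (ListP.map-∘ Ss) ⟨
        sumℚ (map (λ S → F (x ∷ S)) Ss)              ≡⟨ sum-cong Ss (All.universal (λ S →
            solve 4 (λ a r p t → a :* ((r :* p) :* t) := r :* (a :* (p :* t)))
                  refl (f (x ∷ S)) ρ (ρ ^ length S) (q ^ (length xs ∸ length S))) Ss) ⟩
        sumℚ (map (λ S → ρ * (f (x ∷ S) * w S)) Ss)  ≡⟨ *-distribˡ-sum ρ (λ S → f (x ∷ S) * w S) Ss ⟨
        ρ * sumℚ (map (λ S → f (x ∷ S) * w S) Ss)    ≡⟨ cong (ρ *_) (sum-sublists≡𝔼 xs (f ∘ (x ∷_))) ⟩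
        ρ * 𝔼 xs (f ∘ (x ∷_))                        ∎
      without-x : sumℚ (map F Ss) ≡ q * 𝔼 xs f
      without-x = begin
        sumℚ (map F Ss)                       ≡⟨ sum-cong Ss (All.map F≡q*fw (sublists-length xs)) ⟩
        sumℚ (map (λ S → q * (f S * w S)) Ss) ≡⟨ *-distribˡ-sum q (λ S → f S * w S) Ss ⟨
        q * sumℚ (map (λ S → f S * w S) Ss)   ≡⟨ cong (q *_) (sum-sublists≡𝔼 xs f) ⟩
        q * 𝔼 xs f                            ∎
        where
        F≡q*fw : ∀ {S} → length S ℕ.≤ length xs → F S ≡ q * (f S * w S)
        F≡q*fw {S} |S|≤|xs| rewrite ℕP.+-∸-assoc 1 |S|≤|xs| =
          solve 4 (λ a p q t → a :* (p :* (q :* t)) := q :* (a :* (p :* t)))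
                refl (f S) (ρ ^ length S) q (q ^ (length xs ∸ length S))

    weight : Pattern A → ℚ
    weight p = ρ ^ length (opened p) * q ^ length (closed p)

    totalWeight : List (Pattern A) → ℚ
    totalWeight ps = sumℚ (map weight ps)

    totalWeight-++ : ∀ ps qs → totalWeight (ps ++ qs) ≡ totalWeight ps + totalWeight qs
    totalWeight-++ ps qs = trans (cong sumℚ (ListP.map-++ weight ps qs)) (sum-++ (map weight ps) (map weight qs))

    totalWeight-addOpened : ∀ x ps → totalWeight (map (addOpened x) ps) ≡ ρ * totalWeight ps
    totalWeight-addOpened x ps = sum-map-scaled (addOpened x) weight ρ ps λ p → ℚP.*-assoc ρ _ _

    totalWeight-addClosed : ∀ x ps → totalWeight (map (addClosed x) ps) ≡ q * totalWeight ps
    totalWeight-addClosed x ps = sum-map-scaled (addClosed x) weight q ps λ p →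
      solve 3 (λ a q b → a :* (q :* b) := q :* (a :* b)) refl (ρ ^ length (opened p)) q (q ^ length (closed p))

  Prob≡𝔼 : ∀ D (P : Subgraph D → Set) P? → Prob D ρ P P? ≡ 𝔼 (edges D) (λ S → 𝟙 (P? S))
  Prob≡𝔼 D P P? =
    trans (sum-cong (sublists (edges D)) (All.universal (λ S → if-does-then-else-0 (P? S) _) _))
          (sum-sublists≡𝔼 (edges D) (λ S → 𝟙 (P? S)))

  module _ {A : Set} (_≟_ : DecidableEquality A) where

    open Occurrence _≟_
    open import Data.List.Membership.DecPropositional _≟_ using (_∈?_)

    private
      -- Patterns may repeat elements, so x is removed from them entirely.
      remove : A → List A → List A
      remove x = filter (λ y → ¬? (y ≟ x))

      remove-⊆ : ∀ x xs → remove x xs ⊆ xs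
      remove-⊆ x = ⊆P.filter-⊆ (λ y → ¬? (y ≟ x))

      ∉-remove : ∀ x xs → x ∉ remove x xs
      ∉-remove x xs x∈ = proj₂ (∈P.∈-filter⁻ (λ y → ¬? (y ≟ x)) {xs = xs} x∈) refl

      remove-length : ∀ {x xs} → x ∈ xs → suc (length (remove x xs)) ℕ.≤ length xs
      remove-length {x} {xs} x∈xs =
        ListP.filter-notAll (λ y → ¬? (y ≟ x)) xs (Any.map (λ x≡y y≢x → y≢x (sym x≡y)) x∈xs)

      remove-⊆-tail : ∀ {x xs ys} → ys ⊆ x ∷ xs → remove x ys ⊆ xs
      remove-⊆-tail {x} {ys = ys} ys⊆ = ⊆P.⊆∷∧∉⇒⊆ (⊆P.⊆-trans (remove-⊆ x ys) ys⊆) (∉-remove x ys)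

      All-remove : ∀ {P : A → Set} {x} xs → P x → All P (remove x xs) → All P xs
      All-remove           []       px []    = []
      All-remove {x = x} (y ∷ xs) px Pys with y ≟ x
      ... | yes refl = px ∷ All-remove xs px Pys
      ... | no _     = All.head Pys ∷ All-remove xs px (All.tail Pys)

      All-∉-∷ : ∀ {x S} (C : List A) → x ∉ C → All (_∉ S) C → All (_∉ x ∷ S) C
      All-∉-∷ C x∉C C∩S=∅ = All.tabulate λ where
        y∈C (here refl)  → x∉C y∈C
        y∈C (there y∈S) → All.lookup C∩S=∅ y∈C y∈S

    Bound : List A → Set
    Bound xs = ∀ p → Supported xs p → weight p ≤ 𝔼 xs 𝟙[ p occurs-in_]

    private
      module _ {x xs} (x∉xs : x ∉ xs) (IH : Bound xs) where

        open ℚP.≤-Reasoning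

        bound-opened : ∀ p → x ∈ opened p → Supported (x ∷ xs) p → weight p ≤ 𝔼 (x ∷ xs) 𝟙[ p occurs-in_]
        bound-opened p@(⟨ O , C ⟩) x∈O (O⊆ , C⊆ , O∩C) = begin
          ρ ^ length O * q ^ length C
            ≤⟨ *-monoʳ-≤ (^-nonNeg (length C) 0≤q) (^-antimono-≤ 0≤ρ ρ≤1 (remove-length x∈O)) ⟩
          (ρ * ρ ^ length O′) * q ^ length C
            ≡⟨ ℚP.*-assoc ρ _ _ ⟩
          ρ * weight p′
            ≤⟨ *-monoˡ-≤ 0≤ρ (IH p′ (remove-⊆-tail O⊆ , ⊆P.⊆∷∧∉⇒⊆ C⊆ x∉C , O′∩C)) ⟩
          ρ * 𝔼 xs 𝟙[ p′ occurs-in_]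
            ≤⟨ *-monoˡ-≤ 0≤ρ (𝔼-mono xs λ S _ → 𝟙[occurs]-mono occurs-with-x) ⟩
          ρ * 𝔼 xs (𝟙[ p occurs-in_] ∘ (x ∷_))
            ≤⟨ p≤p+q (*-nonNeg 0≤q (𝔼-𝟙-nonNeg xs (occurs? p))) ⟩
          𝔼 (x ∷ xs) 𝟙[ p occurs-in_] ∎
          where
          O′ = remove x O
          p′ = ⟨ O′ , C ⟩
          x∉C : x ∉ C
          x∉C x∈C = O∩C (x∈O , x∈C)
          O′∩C : Disjoint O′ C
          O′∩C (y∈O′ , y∈C) = O∩C (remove-⊆ x O y∈O′ , y∈C)
          occurs-with-x : ∀ {S} → Occurs p′ S → Occurs p (x ∷ S)
          occurs-with-x (O′⊆S , C∩S=∅) = All-remove O (here refl) (All.map there O′⊆S) , All-∉-∷ C x∉C C∩S=∅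

        bound-closed : ∀ p → x ∈ closed p → Supported (x ∷ xs) p → weight p ≤ 𝔼 (x ∷ xs) 𝟙[ p occurs-in_]
        bound-closed p@(⟨ O , C ⟩) x∈C (O⊆ , C⊆ , O∩C) = begin
          ρ ^ length O * q ^ length C
            ≤⟨ *-monoˡ-≤ (^-nonNeg (length O) 0≤ρ) (^-antimono-≤ 0≤q q≤1 (remove-length x∈C)) ⟩
          ρ ^ length O * (q * q ^ length C′)
            ≡⟨ solve 3 (λ a q b → a :* (q :* b) := q :* (a :* b)) refl (ρ ^ length O) q (q ^ length C′) ⟩
          q * weight p′
            ≤⟨ *-monoˡ-≤ 0≤q (IH p′ (⊆P.⊆∷∧∉⇒⊆ O⊆ x∉O , remove-⊆-tail C⊆ , O∩C′)) ⟩
          q * 𝔼 xs 𝟙[ p′ occurs-in_]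
            ≤⟨ *-monoˡ-≤ 0≤q (𝔼-mono xs λ S S⊆xs → 𝟙[occurs]-mono (occurs-without-x (x∉xs ∘ S⊆xs))) ⟩
          q * 𝔼 xs 𝟙[ p occurs-in_]
            ≤⟨ q≤p+q (*-nonNeg 0≤ρ (𝔼-𝟙-nonNeg xs (occurs? p ∘ (x ∷_)))) ⟩
          𝔼 (x ∷ xs) 𝟙[ p occurs-in_] ∎
          where
          C′ = remove x C
          p′ = ⟨ O , C′ ⟩
          x∉O : x ∉ O
          x∉O x∈O = O∩C (x∈O , x∈C)
          O∩C′ : Disjoint O C′
          O∩C′ (y∈O , y∈C′) = O∩C (y∈O , remove-⊆ x C y∈C′)
          occurs-without-x : ∀ {S} → x ∉ S → Occurs p′ S → Occurs p S
          occurs-without-x x∉S (O⊆S , C′∩S=∅) = O⊆S , All-remove C x∉S C′∩S=∅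

        bound-neither : ∀ p → x ∉ opened p → x ∉ closed p → Supported (x ∷ xs) p →
                        weight p ≤ 𝔼 (x ∷ xs) 𝟙[ p occurs-in_]
        bound-neither p@(⟨ O , C ⟩) x∉O x∉C (O⊆ , C⊆ , O∩C) = begin
          weight p
            ≡⟨ solve 2 (λ r w → r :* w :+ (con 1ℚ :- r) :* w := w) refl ρ (weight p) ⟨
          ρ * weight p + q * weight p
            ≤⟨ ℚP.+-mono-≤ (*-monoˡ-≤ 0≤ρ (ℚP.≤-trans IH′ (𝔼-mono xs λ S _ → 𝟙[occurs]-mono occurs-with-x)))
                           (*-monoˡ-≤ 0≤q IH′) ⟩
          𝔼 (x ∷ xs) 𝟙[ p occurs-in_] ∎
          where
          IH′ : weight p ≤ 𝔼 xs 𝟙[ p occurs-in_]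
          IH′ = IH p (⊆P.⊆∷∧∉⇒⊆ O⊆ x∉O , ⊆P.⊆∷∧∉⇒⊆ C⊆ x∉C , O∩C)
          occurs-with-x : ∀ {S} → Occurs p S → Occurs p (x ∷ S)
          occurs-with-x (O⊆S , C∩S=∅) = All.map there O⊆S , All-∉-∷ C x∉C C∩S=∅

        Bound-∷ : Bound (x ∷ xs)
        Bound-∷ p supp with x ∈? opened p | x ∈? closed p
        ... | yes x∈O | _       = bound-opened p x∈O supp
        ... | no x∉O  | yes x∈C = bound-closed p x∈C supp
        ... | no x∉O  | no x∉C  = bound-neither p x∉O x∉C supp

    weight≤𝔼𝟙[occurs] : ∀ xs → Unique xs → Bound xs
    weight≤𝔼𝟙[occurs] []       _ ⟨ [] , [] ⟩    _            = ℚP.≤-refl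
    weight≤𝔼𝟙[occurs] []       _ ⟨ _ ∷ _ , _ ⟩  (O⊆ , _)     = contradiction (O⊆ (here refl)) λ ()
    weight≤𝔼𝟙[occurs] []       _ ⟨ [] , _ ∷ _ ⟩ (_ , C⊆ , _) = contradiction (C⊆ (here refl)) λ ()
    weight≤𝔼𝟙[occurs] (x ∷ xs) (x≢xs AllPairs.∷ u) =
      Bound-∷ (AllP.All¬⇒¬Any x≢xs) (weight≤𝔼𝟙[occurs] xs u)

  greedyProb : ℕ → ℚ
  greedyProb zero    = 1ℚ
  greedyProb (suc n) = (1ℚ - q ^ suc n) * greedyProb n

  module _ {D : ℕ} where

    open Occurrence (_≟ᵉ_ {D})

    firstOpen-weight : ∀ (next : V D → List (Pattern (Edge D))) c es →
                       (∀ {e} → e ∈ es → totalWeight (next (proj₂ e)) ≡ c) →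
                       totalWeight (firstOpen next es) ≡ (1ℚ - q ^ length es) * c
    firstOpen-weight next c []       _ = sym (trans (cong (_* c) (ℚP.+-inverseʳ 1ℚ)) (ℚP.*-zeroˡ c))
    firstOpen-weight next c (e ∷ es) h = begin
      totalWeight (map (addOpened e) through-e ++ map (addClosed e) past-e)
        ≡⟨ totalWeight-++ (map (addOpened e) through-e) (map (addClosed e) past-e) ⟩
      totalWeight (map (addOpened e) through-e) + totalWeight (map (addClosed e) past-e)
        ≡⟨ cong₂ _+_ (totalWeight-addOpened e through-e) (totalWeight-addClosed e past-e) ⟩
      ρ * totalWeight through-e + q * totalWeight past-e
        ≡⟨ cong₂ (λ a b → ρ * a + q * b) (h (here refl)) (firstOpen-weight next c es (h ∘ there)) ⟩
      ρ * c + q * ((1ℚ - q ^ length es) * c)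
        ≡⟨ solve 3 (λ r Q c → r :* c :+ (con 1ℚ :- r) :* ((con 1ℚ :- Q) :* c)
                            := (con 1ℚ :- (con 1ℚ :- r) :* Q) :* c) refl ρ (q ^ length es) c ⟩
      (1ℚ - q ^ length (e ∷ es)) * c ∎
      where
      open ≡-Reasoning
      through-e = next (proj₂ e)
      past-e = firstOpen next es

    greedy-weight : ∀ n v → n ℕ.+ layer v ≡ D → totalWeight (greedy n v) ≡ greedyProb n
    greedy-weight zero    v _  = trans (ℚP.+-identityʳ _) (ℚP.*-identityˡ 1ℚ)
    greedy-weight (suc n) v eq = trans
      (firstOpen-weight (greedy n) (greedyProb n) (edgesFrom v) λ {e} e∈ → greedy-weight n (proj₂ e)
         (trans (cong (n ℕ.+_) (edgesFrom-layer e∈)) (trans (ℕP.+-suc n (layer v)) eq)))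
      (cong (λ k → (1ℚ - q ^ k) * greedyProb n) |edgesFrom|≡1+n)
      where
      |edgesFrom|≡1+n : length (edgesFrom v) ≡ suc n
      |edgesFrom|≡1+n = ℕP.+-cancelʳ-≡ (layer v) _ _ (trans (length-edgesFrom v) (sym eq))

    greedyProb≤Prob : (P? : ∀ S → Dec (HasMaxMonotonePath S)) →
                      greedyProb D ≤ Prob D ρ HasMaxMonotonePath P?
    greedyProb≤Prob P? = begin
      greedyProb D
        ≡⟨ greedy-weight D 0⃗ D+0≡D ⟨
      totalWeight (greedy D 0⃗)
        ≤⟨ sum-mono (greedy D 0⃗) (All.map weight≤𝔼 (greedy-wellFormed D 0⃗)) ⟩
      sumℚ (map (λ p → 𝔼 E 𝟙[ p occurs-in_]) (greedy D 0⃗))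
        ≡⟨ 𝔼-sum E (greedy D 0⃗) 𝟙[_occurs-in_] ⟨
      𝔼 E (count (greedy D 0⃗))
        ≤⟨ 𝔼-mono E (λ S _ → ZeroOrOneWith⇒≤𝟙 (greedy-count D 0⃗ S) (P? S) UpPath⇒HasMaxMonotonePath) ⟩
      𝔼 E (λ S → 𝟙 (P? S))
        ≡⟨ Prob≡𝔼 D HasMaxMonotonePath P? ⟨
      Prob D ρ HasMaxMonotonePath P? ∎
      where
      open ℚP.≤-Reasoning
      E = edges D
      0⃗ : V D
      0⃗ = replicate D false
      D+0≡D : D ℕ.+ layer 0⃗ ≡ D
      D+0≡D = trans (cong (D ℕ.+_) (layer-replicate D)) (ℕP.+-identityʳ D)
      weight≤𝔼 : ∀ {p} → WellFormed (Above (layer 0⃗)) (Above (layer 0⃗)) p → weight p ≤ 𝔼 E 𝟙[ p occurs-in_]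
      weight≤𝔼 {p} (O-above , C-above , O∩C) = weight≤𝔼𝟙[occurs] _≟ᵉ_ E edges-unique p
        (proj₁ ∘ All.lookup O-above , proj₁ ∘ All.lookup C-above , O∩C)

  m[m-1]-nonNeg : ∀ m → 0ℚ ≤ fromℕ m * (fromℕ m - 1ℚ)
  m[m-1]-nonNeg zero    = ℚP.≤-reflexive (sym (ℚP.*-zeroˡ (0ℚ - 1ℚ)))
  m[m-1]-nonNeg (suc m) rewrite fromℕ-suc m =
    subst (0ℚ ≤_) (solve 1 (λ t → (con 1ℚ :+ t) :* t := (con 1ℚ :+ t) :* ((con 1ℚ :+ t) :- con 1ℚ))
                           refl (fromℕ m))
          (*-nonNeg (+-nonNeg 0≤1 (/-nonNeg m 0)) (/-nonNeg m 0))

  bonferroni : ∀ m → ρ * fromℕ m - ρ * ρ * ½ * (fromℕ m * (fromℕ m - 1ℚ)) ≤ 1ℚ - q ^ m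
  bonferroni zero    = ℚP.≤-reflexive
    (solve 1 (λ r → r :* con 0ℚ :- r :* r :* con ½ :* (con 0ℚ :* (con 0ℚ :- con 1ℚ)) := con 1ℚ :- con 1ℚ)
             refl ρ)
  bonferroni (suc m) rewrite fromℕ-suc m = begin
    ρ * (1ℚ + t) - ρ * ρ * ½ * ((1ℚ + t) * ((1ℚ + t) - 1ℚ))
      ≤⟨ p≤p+q (*-nonNeg (*-nonNeg (*-nonNeg (*-nonNeg 0≤ρ 0≤ρ) 0≤ρ) 0≤½) (m[m-1]-nonNeg m)) ⟩
    ρ * (1ℚ + t) - ρ * ρ * ½ * ((1ℚ + t) * ((1ℚ + t) - 1ℚ)) + ρ * ρ * ρ * ½ * (t * (t - 1ℚ))
      ≡⟨ solve 2 (λ r t → r :* (con 1ℚ :+ t) :- r :* r :* con ½ :* ((con 1ℚ :+ t) :* ((con 1ℚ :+ t) :- con 1ℚ))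
                            :+ r :* r :* r :* con ½ :* (t :* (t :- con 1ℚ))
                          := r :+ (con 1ℚ :- r) :* (r :* t :- r :* r :* con ½ :* (t :* (t :- con 1ℚ))))
                 refl ρ t ⟩
    ρ + q * (ρ * t - ρ * ρ * ½ * (t * (t - 1ℚ)))
      ≤⟨ ℚP.+-monoʳ-≤ ρ (*-monoˡ-≤ 0≤q (bonferroni m)) ⟩
    ρ + q * (1ℚ - q ^ m)
      ≡⟨ solve 2 (λ r Q → r :+ (con 1ℚ :- r) :* (con 1ℚ :- Q) := con 1ℚ :- (con 1ℚ :- r) :* Q) refl ρ (q ^ m) ⟩
    1ℚ - q ^ suc m ∎
    where
    open ℚP.≤-Reasoning
    t = fromℕ m

  ρm/2≤1-qᵐ : ∀ m → ρ * fromℕ m ≤ 1ℚ → ρ * fromℕ m * ½ ≤ 1ℚ - q ^ m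
  ρm/2≤1-qᵐ m ρm≤1 = begin
    ρ * t * ½
      ≤⟨ p≤p+q (*-nonNeg 0≤ρt½ (0≤1-p ρ[t-1]≤1)) ⟩
    ρ * t * ½ + ρ * t * ½ * (1ℚ - ρ * (t - 1ℚ))
      ≡⟨ solve 2 (λ r t → r :* t :* con ½ :+ r :* t :* con ½ :* (con 1ℚ :- r :* (t :- con 1ℚ))
                        := r :* t :- r :* r :* con ½ :* (t :* (t :- con 1ℚ))) refl ρ t ⟩
    ρ * t - ρ * ρ * ½ * (t * (t - 1ℚ))
      ≤⟨ bonferroni m ⟩
    1ℚ - q ^ m ∎
    where
    open ℚP.≤-Reasoning
    t = fromℕ m
    0≤ρt½ : 0ℚ ≤ ρ * t * ½
    0≤ρt½ = *-nonNeg (*-nonNeg 0≤ρ (/-nonNeg m 0)) 0≤½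
    ρ[t-1]≤1 : ρ * (t - 1ℚ) ≤ 1ℚ
    ρ[t-1]≤1 = ℚP.≤-trans (*-monoˡ-≤ 0≤ρ (p-q≤p 0≤1)) ρm≤1

  pow≤greedyProb*expTerm : ∀ {x} → 0ℚ ≤ x → ∀ n → ρ * fromℕ n ≤ 1ℚ →
                           (ρ * (x * ½)) ^ n ≤ greedyProb n * expTerm x n
  pow≤greedyProb*expTerm     0≤x zero    _        = ℚP.≤-reflexive (sym (ℚP.*-identityˡ 1ℚ))
  pow≤greedyProb*expTerm {x} 0≤x (suc n) ρ[1+n]≤1 = begin
    ρ * (x * ½) * (ρ * (x * ½)) ^ n
      ≡⟨ cong (_* (ρ * (x * ½)) ^ n) ρx½≡ρt½*xr ⟩
    ρ * t * ½ * (x * r) * (ρ * (x * ½)) ^ n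
      ≤⟨ *-mono-≤ (*-nonNeg 0≤ρt½ 0≤xr) (^-nonNeg n (*-nonNeg 0≤ρ (*-nonNeg 0≤x 0≤½)))
                  (*-monoʳ-≤ 0≤xr (ρm/2≤1-qᵐ (suc n) ρ[1+n]≤1))
                  (pow≤greedyProb*expTerm 0≤x n ρn≤1) ⟩
    (1ℚ - q ^ suc n) * (x * r) * (greedyProb n * expTerm x n)
      ≡⟨ solve 5 (λ a x r g E → a :* (x :* r) :* (g :* E) := a :* g :* (E :* x :* r))
                 refl (1ℚ - q ^ suc n) x r (greedyProb n) (expTerm x n) ⟩
    greedyProb (suc n) * expTerm x (suc n) ∎
    where
    open ℚP.≤-Reasoning
    t = fromℕ (suc n)
    r = + 1 / suc n
    ρx½≡ρt½*xr : ρ * (x * ½) ≡ ρ * t * ½ * (x * r)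
    ρx½≡ρt½*xr = trans
      (sym (trans (cong (ρ * (x * ½) *_) (trans (fromℕ*1/ (suc n) n) (n/n≡1 n))) (ℚP.*-identityʳ (ρ * (x * ½)))))
      (solve 4 (λ a x t r → a :* (x :* con ½) :* (t :* r) := a :* t :* con ½ :* (x :* r)) refl ρ x t r)
    0≤ρt½ : 0ℚ ≤ ρ * t * ½
    0≤ρt½ = *-nonNeg (*-nonNeg 0≤ρ (/-nonNeg (suc n) 0)) 0≤½
    0≤xr : 0ℚ ≤ x * r
    0≤xr = *-nonNeg 0≤x (/-nonNeg 1 n)
    ρn≤1 : ρ * fromℕ n ≤ 1ℚ
    ρn≤1 = ℚP.≤-trans (*-monoˡ-≤ 0≤ρ (fromℕ-mono-≤ (ℕP.n≤1+n n))) ρ[1+n]≤1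

lemma2p3 : (D : ℕ) → D ≥ 1 → (ρ : ℚ) → 0ℚ ≤ ρ → ρ * ((+ D) / 1) ≤ (+ 1) / 1 →
    (dec : (S : Subgraph D) → Dec (HasMaxMonotonePath S)) →
    (ε : ℚ) → 0ℚ < ε →
    ∃ λ N → (ρ * ((+ D) / 2)) ^ D
      ≤ Prob D ρ HasMaxMonotonePath dec * expPartial ((+ D) / 1) N + ε
lemma2p3 D D≥1 ρ 0≤ρ ρD≤1 dec ε 0<ε = suc D , (begin
  (ρ * (+ D / 2)) ^ D          ≡⟨ cong (λ y → (ρ * y) ^ D) (fromℕ*1/ D 1) ⟨
  (ρ * (x * ½)) ^ D            ≤⟨ pow≤greedyProb*expTerm 0≤x D ρD≤1 ⟩
  greedyProb D * expTerm x D   ≤⟨ *-monoʳ-≤ (expTerm-nonNeg 0≤x D) (greedyProb≤Prob dec) ⟩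
  P * expTerm x D              ≤⟨ *-monoˡ-≤ 0≤P (q≤p+q (expPartial-nonNeg 0≤x D)) ⟩
  P * expPartial x (suc D)     ≤⟨ p≤p+q (ℚP.<⇒≤ 0<ε) ⟩
  P * expPartial x (suc D) + ε ∎)
  where
  open ℚP.≤-Reasoning
  ρ≤1 : ρ ≤ 1ℚ
  ρ≤1 = subst (_≤ 1ℚ) (ℚP.*-identityʳ ρ) (ℚP.≤-trans (*-monoˡ-≤ 0≤ρ (fromℕ-mono-≤ D≥1)) ρD≤1)
  open Bernoulli ρ 0≤ρ ρ≤1
  x = fromℕ D
  0≤x : 0ℚ ≤ x
  0≤x = /-nonNeg D 0
  P = Prob D ρ HasMaxMonotonePath dec
  0≤P : 0ℚ ≤ P
  0≤P = subst (0ℚ ≤_) (sym (Prob≡𝔼 D HasMaxMonotonePath dec)) (𝔼-𝟙-nonNeg (edges D) dec)
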